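{- Let $D$ be a digraph with potential function $\phi$, let $S_{min}$ be an inclusion-wise minimal feasible solution for $(D,\phi)$, and let $Z_{min}$ be the set of sinks of $D-S_{min}$. If $x\in Z_{min}$, then $N^+(x)\subseteq S_{min}$, $S_{min}\cap R^-(x)=\emptyset$, and $Z_{min}\cap (R^+(x)\setminus\{x\})=\emptyset$.
   Context: All digraphs are finite, without loops or parallel arcs; $N^+(v)$ and $N^-(v)$ denote out- and in-neighbourhoods in $D$. A sink is a vertex of out-degree $0$. A knot in a digraph is a strongly connected component of size at least $2$ with no arc leaving it; a digraph is knot-free if it has no knot. A potential function is a map $\phi:V(D)\to\{0.25,1\}$; vertices with $\phi(v)=1$ are called undecided and their set is denoted $\mathcal{U}$. A set $S\subseteq V(D)$ is a feasible solution for $(D,\phi)$ if $D-S$ (the subgraph induced on $V(D)\setminus S$) is knot-free and every sink $s$ of $D-S$ satisfies $\phi(s)=1$. For $v\in V(D)$, $R^-(v)$ is the set of vertices $u$ having a directed path to $v$ in $D-N^+(v)$ (in particular $v\in R^-(v)$), and $R^+(v)=\{u\in\mathcal{U} : v\in R^-(u)\}$. -}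

module Defs where

open import Data.Nat using (ℕ)
open import Data.Fin using (Fin)
open import Data.Fin.Subset using (Subset; _∈_; _∉_; _⊆_)
open import Data.Bool using (Bool; true; false)
open import Data.Product using (Σ; _×_; ∃)
open import Data.Sum using (_⊎_)
open import Relation.Binary.PropositionalEquality using (_≡_; _≢_)
open import Relation.Nullary using (¬_)

-- A finite digraph on vertex set Fin n, without loops (parallel arcs are
-- impossible since the arc relation is a Bool-valued function).
record Digraph : Set where
  field
    n        : ℕ
    arc      : Fin n → Fin n → Bool
    loopless : ∀ v → arc v v ≡ false
open Digraph public

Vertex : Digraph → Set
Vertex D = Fin (n D)

VSet : Digraph → Set
VSet D = Subset (n D)

Arc : (D : Digraph) → Vertex D → Vertex D → Set
Arc D u v = arc D u v ≡ true

InN⁺ : (D : Digraph) → Vertex D → Vertex D → Set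
InN⁺ D v w = Arc D v w

data Pot : Set where
  quarter one : Pot

Potential : Digraph → Set
Potential D = Vertex D → Pot

Undecided : (D : Digraph) → Potential D → Vertex D → Set
Undecided D φ v = φ v ≡ one

data Reach (D : Digraph) (ok : Vertex D → Set) : Vertex D → Vertex D → Set where
  here : ∀ {u} → ok u → Reach D ok u u
  step : ∀ {u w v} → ok u → Arc D u w → Reach D ok w v → Reach D ok u v

InDminus : (D : Digraph) → VSet D → Vertex D → Set
InDminus D S v = v ∉ S

Sink : (D : Digraph) → VSet D → Vertex D → Set
Sink D S v = v ∉ S × (∀ w → w ∉ S → ¬ Arc D v w)

-- K is a knot of D - S: a strongly connected component of D - S (a maximal
-- set of vertices of D - S that are pairwise mutually reachable in D - S)
-- of size at least 2 with no arc of D - S leaving it.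
IsKnot : (D : Digraph) → VSet D → VSet D → Set
IsKnot D S K =
    (∀ v → v ∈ K → v ∉ S)
  × (∀ u v → u ∈ K → v ∈ K → Reach D (InDminus D S) u v)
  × (∀ u v → u ∈ K → v ∉ S → Reach D (InDminus D S) u v
             → Reach D (InDminus D S) v u → v ∈ K)
  × (Σ (Vertex D) λ u → Σ (Vertex D) λ v → u ∈ K × v ∈ K × u ≢ v)
  × (∀ u v → u ∈ K → v ∉ S → Arc D u v → v ∈ K)

KnotFree : (D : Digraph) → VSet D → Set
KnotFree D S = ∀ K → ¬ IsKnot D S K

Feasible : (D : Digraph) → Potential D → VSet D → Set
Feasible D φ S = KnotFree D S × (∀ s → Sink D S s → φ s ≡ one)

MinimalFeasible : (D : Digraph) → Potential D → VSet D → Set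
MinimalFeasible D φ S =
  Feasible D φ S × (∀ T → T ⊆ S → Feasible D φ T → S ⊆ T)

InR⁻ : (D : Digraph) → Vertex D → Vertex D → Set
InR⁻ D v u = Reach D (λ w → ¬ InN⁺ D v w) u v

InR⁺ : (D : Digraph) → Potential D → Vertex D → Vertex D → Set
InR⁺ D φ v u = Undecided D φ u × InR⁻ D u v

{-# OPTIONS --safe #-}
-- If a vertex s ∈ Smin had a walk to the sink x of D - Smin avoiding N⁺(x),
-- take the last vertex of Smin on it.  Putting that vertex back into the
-- graph keeps the solution feasible: it is not a sink (its successor on the
-- walk survives), x stays a sink, and a new knot would have to contain it,
-- hence also x, which is impossible for a sink.  This contradicts minimality.
-- The statement about R⁺(x) follows by applying this to the other sink z.
module Submission where

open import Defs
open import Data.Fin.Subset using (Subset; _∈_; _∉_; _⊆_; _─_; _-_; outside)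
open import Data.Fin.Subset.Properties using (_∈?_; x∈⁅x⁆; p─q⊆p; x∈p∧x≢y⇒x∈p-y)
open import Data.Fin.Base using (Fin)
open import Data.Fin.Properties using (_≟_)
open import Data.Product using (_×_; _,_; ∃₂)
open import Data.Sum using (_⊎_; inj₁; inj₂)
open import Data.Vec.Base using (_∷_; here; there)
open import Relation.Binary.PropositionalEquality using (_≡_; _≢_; refl; sym)
open import Relation.Nullary using (¬_; yes; no; contradiction)
open import Data.Empty using (⊥)

x∈p─q⇒x∉q : ∀ {n} {x : Fin n} (p q : Subset n) → x ∈ p ─ q → x ∉ q
x∈p─q⇒x∉q (_ ∷ _) (outside ∷ _) here      ()
x∈p─q⇒x∉q (_ ∷ p) (_       ∷ q) (there x∈p─q) (there x∈q) = x∈p─q⇒x∉q p q x∈p─q x∈q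

x∉p-x : ∀ {n} (p : Subset n) (x : Fin n) → x ∉ p - x
x∉p-x p x x∈p-x = x∈p─q⇒x∉q p _ x∈p-x (x∈⁅x⁆ x)

x∉p-y∧x≢y⇒x∉p : ∀ {n} {p : Subset n} {x y : Fin n} → x ∉ p - y → x ≢ y → x ∉ p
x∉p-y∧x≢y⇒x∉p x∉p-y x≢y x∈p = x∉p-y (x∈p∧x≢y⇒x∈p-y x∈p x≢y)

module _ {D : Digraph} where

  Reach-mono : ∀ {P Q : Vertex D → Set} → (∀ {v} → P v → Q v)
             → ∀ {u v} → Reach D P u v → Reach D Q u v
  Reach-mono P⇒Q (here Pu)          = here (P⇒Q Pu)
  Reach-mono P⇒Q (step Pu u→w w⇝v) = step (P⇒Q Pu) u→w (Reach-mono P⇒Q w⇝v)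

  Reach-source : ∀ {P : Vertex D → Set} {u v} → Reach D P u v → P u
  Reach-source (here Pu)     = Pu
  Reach-source (step Pu _ _) = Pu

  Reach-target : ∀ {P : Vertex D → Set} {u v} → Reach D P u v → P v
  Reach-target (here Pv)      = Pv
  Reach-target (step _ _ w⇝v) = Reach-target w⇝v

  Reach-lastExit : ∀ {P : Vertex D → Set} (S : VSet D) {u x}
                 → Reach D P u x → x ∉ S
                 → Reach D (InDminus D S) u x
                   ⊎ ∃₂ λ s w → s ∈ S × P s × Arc D s w × Reach D (InDminus D S) w x
  Reach-lastExit S (here _) x∉S = inj₁ (here x∉S)
  Reach-lastExit S {u} (step Pu u→w w⇝x) x∉S with Reach-lastExit S w⇝x x∉S
  ... | inj₂ exit = inj₂ exit
  ... | inj₁ w⇝x∖S with u ∈? S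
  ...   | yes u∈S = inj₂ (u , _ , u∈S , Pu , u→w , w⇝x∖S)
  ...   | no  u∉S = inj₁ (step u∉S u→w w⇝x∖S)

  Sink-N⁺⊆ : ∀ {S x y} → Sink D S x → InN⁺ D x y → y ∈ S
  Sink-N⁺⊆ {S} {y = y} (_ , noArc) x→y with y ∈? S
  ... | yes y∈S = y∈S
  ... | no  y∉S = contradiction x→y (noArc y y∉S)

  Sink-⊆ : ∀ {S T s} → T ⊆ S → s ∉ S → Sink D T s → Sink D S s
  Sink-⊆ T⊆S s∉S (_ , noArc) = s∉S , λ w w∉S → noArc w (λ w∈T → w∉S (T⊆S w∈T))

  Sink-remove : ∀ {S x u} → Sink D S x → ¬ Arc D x u → Sink D (S - u) x
  Sink-remove {S} {u = u} (x∉S , noArc) x↛u =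
    (λ x∈S-u → x∉S (p─q⊆p S _ x∈S-u)) , noArc′
    where
    noArc′ : ∀ w → w ∉ S - u → ¬ Arc D _ w
    noArc′ w w∉S-u with w ≟ u
    ... | yes refl = x↛u
    ... | no  w≢u  = noArc w (x∉p-y∧x≢y⇒x∉p w∉S-u w≢u)

  Sink-Reach⇒≡ : ∀ {S x v} → Sink D S x → Reach D (InDminus D S) x v → v ≡ x
  Sink-Reach⇒≡ _           (here _)          = refl
  Sink-Reach⇒≡ (_ , noArc) (step _ x→w w⇝v) = contradiction x→w (noArc _ (Reach-source w⇝v))

  IsKnot-Reach⇒Reach∈ : ∀ {S K u v} → IsKnot D S K → u ∈ K
                      → Reach D (InDminus D S) u v → Reach D (_∈ K) u v
  IsKnot-Reach⇒Reach∈ _ u∈K (here _) = here u∈K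
  IsKnot-Reach⇒Reach∈ knot@(_ , _ , _ , _ , closed) u∈K (step _ u→w w⇝v) =
    step u∈K u→w (IsKnot-Reach⇒Reach∈ knot (closed _ _ u∈K (Reach-source w⇝v) u→w) w⇝v)

  IsKnot-∌Sink : ∀ {S K x} → IsKnot D S K → x ∈ K → ¬ Sink D S x
  IsKnot-∌Sink {x = x} (_ , connected , _ , (a , b , a∈K , b∈K , a≢b) , _) x∈K x-sink
    with a ≟ x
  ... | yes refl = a≢b (sym (Sink-Reach⇒≡ x-sink (connected a b a∈K b∈K)))
  ... | no  a≢x  = a≢x (Sink-Reach⇒≡ x-sink (connected x a x∈K a∈K))

  IsKnot-⊆ : ∀ {S T K} → T ⊆ S → (∀ v → v ∈ K → v ∉ S) → IsKnot D T K → IsKnot D S K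
  IsKnot-⊆ {S} {T} {K} T⊆S K∩S=∅ knot@(_ , connected , maximal , nontrivial , closed) =
    K∩S=∅ , connectedS , maximalS , nontrivial , λ u v u∈K v∉S → closed u v u∈K (∉T v∉S)
    where
    ∉T : ∀ {v} → v ∉ S → v ∉ T
    ∉T v∉S v∈T = v∉S (T⊆S v∈T)
    connectedS : ∀ u v → u ∈ K → v ∈ K → Reach D (InDminus D S) u v
    connectedS u v u∈K v∈K =
      Reach-mono (K∩S=∅ _) (IsKnot-Reach⇒Reach∈ knot u∈K (connected u v u∈K v∈K))
    maximalS : ∀ u v → u ∈ K → v ∉ S → Reach D (InDminus D S) u v
             → Reach D (InDminus D S) v u → v ∈ K
    maximalS u v u∈K v∉S u⇝v v⇝u =
      maximal u v u∈K (∉T v∉S) (Reach-mono ∉T u⇝v) (Reach-mono ∉T v⇝u)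

  KnotFree-remove : ∀ {S u x} → KnotFree D S → Sink D (S - u) x
                  → Reach D (InDminus D (S - u)) u x → KnotFree D (S - u)
  KnotFree-remove {S} {u} knotFree x-sink u⇝x K knot@(K∩S-u=∅ , _) with u ∈? K
  ... | yes u∈K = IsKnot-∌Sink knot (Reach-target (IsKnot-Reach⇒Reach∈ knot u∈K u⇝x)) x-sink
  ... | no  u∉K = knotFree K (IsKnot-⊆ (p─q⊆p S _) K∩S=∅ knot)
    where
    K∩S=∅ : ∀ v → v ∈ K → v ∉ S
    K∩S=∅ v v∈K = x∉p-y∧x≢y⇒x∉p (K∩S-u=∅ v v∈K) λ { refl → u∉K v∈K }

  Feasible-remove : ∀ {φ S x u w} → Feasible D φ S → Sink D S x → ¬ Arc D x u
                  → Arc D u w → Reach D (InDminus D S) w x → Feasible D φ (S - u)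
  Feasible-remove {φ} {S} {x} {u} {w} (knotFree , sinks-undecided) x-sink x↛u u→w w⇝x =
    KnotFree-remove knotFree x-sink′ (step (x∉p-x S u) u→w (Reach-mono ∉S-u w⇝x)) ,
    sinks-undecided′
    where
    ∉S-u : ∀ {v} → v ∉ S → v ∉ S - u
    ∉S-u v∉S v∈S-u = v∉S (p─q⊆p S _ v∈S-u)
    x-sink′ : Sink D (S - u) x
    x-sink′ = Sink-remove x-sink x↛u
    sinks-undecided′ : ∀ s → Sink D (S - u) s → φ s ≡ one
    sinks-undecided′ s s-sink@(s∉S-u , noArc) with s ≟ u
    ... | yes refl = contradiction u→w (noArc w (∉S-u (Reach-source w⇝x)))
    ... | no  s≢u  = sinks-undecided s (Sink-⊆ (p─q⊆p S _) (x∉p-y∧x≢y⇒x∉p s∉S-u s≢u) s-sink)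

  MinimalFeasible-irremovable : ∀ {φ S u} → MinimalFeasible D φ S → u ∈ S
                              → ¬ Feasible D φ (S - u)
  MinimalFeasible-irremovable {S = S} {u} (_ , minimal) u∈S feasible =
    x∉p-x S u (minimal (S - u) (p─q⊆p S _) feasible u∈S)

  MinimalFeasible-R⁻∩=∅ : ∀ {φ S x u} → MinimalFeasible D φ S → Sink D S x
                        → InR⁻ D x u → u ∉ S
  MinimalFeasible-R⁻∩=∅ {S = S} minFeasible@(feasible , _) x-sink@(x∉S , _) u⇝x u∈S
    with Reach-lastExit S u⇝x x∉S
  ... | inj₁ u⇝x∖S = Reach-source u⇝x∖S u∈S
  ... | inj₂ (s , w , s∈S , x↛s , s→w , w⇝x) =
    MinimalFeasible-irremovable minFeasible s∈S (Feasible-remove feasible x-sink x↛s s→w w⇝x)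

  MinimalFeasible-R⁺-sink⇒≡ : ∀ {φ S x z} → MinimalFeasible D φ S → Sink D S x
                            → Sink D S z → InR⁺ D φ x z → z ≡ x
  MinimalFeasible-R⁺-sink⇒≡ _ _ _ (_ , here _) = refl
  MinimalFeasible-R⁺-sink⇒≡ minFeasible x-sink z-sink (_ , step _ x→w w⇝z) =
    contradiction (Sink-N⁺⊆ x-sink x→w) (MinimalFeasible-R⁻∩=∅ minFeasible z-sink w⇝z)

proposition2 : (D : Digraph) (φ : Potential D) (Smin : VSet D)
    → MinimalFeasible D φ Smin
    → (x : Vertex D) → Sink D Smin x
    → (∀ y → InN⁺ D x y → y ∈ Smin)
      × (∀ u → InR⁻ D x u → u ∉ Smin)
      × (∀ z → Sink D Smin z → InR⁺ D φ x z → z ≢ x → ⊥)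
proposition2 D φ Smin minFeasible x x-sink =
    (λ _ → Sink-N⁺⊆ {D = D} x-sink)
  , (λ _ → MinimalFeasible-R⁻∩=∅ minFeasible x-sink)
  , λ _ z-sink z∈R⁺ z≢x → z≢x (MinimalFeasible-R⁺-sink⇒≡ minFeasible x-sink z-sink z∈R⁺)
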